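{- For a positive integer $m$, define the sequence $c^{(m)}$ by $c^{(m)}(1)=m$ and, for $n\ge2$, $$c^{(m)}(n)=c^{(m)}(n-1)+\begin{cases}\gcd(n,\,c^{(m)}(n-1)), & n \text{ even},\\ \gcd(n-2,\,c^{(m)}(n-1)), & n\text{ odd}.\end{cases}$$ Let $m>3$ be an integer. Then $m-2$ and $m$ are both prime if and only if $c^{(m)}(n)-c^{(m)}(n-1)=1$ for every $n$ with $2\le n\le m$. -}

module Defs where

open import Data.Nat using (ℕ; zero; suc; _+_; _∸_; _≟_)
open import Data.Nat.DivMod using (_%_)
open import Data.Nat.GCD using (gcd)
open import Data.Bool using (if_then_else_)
open import Relation.Nullary.Decidable using (does)

-- c m n  =  c^{(m)}(n)  for n ≥ 1.  The value at n = 0 is junk (set to m) and never used.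
c : ℕ → ℕ → ℕ
c m zero = m
c m (suc zero) = m
c m (suc (suc k)) =
  let n    = suc (suc k)
      prev = c m (suc k)
  in prev + (if does (n % 2 ≟ 0) then gcd n prev else gcd (n ∸ 2) prev)

module Submission where

-- Write m = 2 + p.  An increment c m n ∸ c m (n ∸ 1) is a gcd
-- term of n and the previous value, so as long as all earlier increments are
-- 1 the sequence runs along the line c m (1 + k) = m + k, and the increment at
-- n = 2 + k is the gcd term of 2 + k and m + k.  Reducing these gcds modulo
-- their first argument, "all increments on [2, m] are 1" becomes a sieve:
--   * every even n = 2 + k ≤ 2 + p is coprime to p, and
--   * every odd d ≤ p is coprime to 2 + p.
-- This sieve holds exactly for twin primes p, 2 + p: an odd prime p cannot
-- divide an even n ≤ 2 + p, and a proper divisor d of p yields the even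
-- number d + d ≤ p sharing d with p; dually for 2 + p and its odd divisors.

open import Defs
open import Data.Nat using (ℕ; _+_; _∸_; _≤_; _<_)
open import Data.Nat.Primality using (Prime)
open import Data.Product using (_×_)
open import Function.Bundles using (_⇔_)
open import Relation.Binary.PropositionalEquality using (_≡_)

open import Data.Nat using (zero; suc; _*_; _%_; _≟_; z≤n; s≤s; s≤s⁻¹; n>1⇒nonTrivial)
open import Data.Nat.Properties
  using (+-identityʳ; +-suc; +-comm; +-assoc; *-comm; ≤-trans; ≤-antisym; <⇒≤; m≤n⇒m<n∨m≡n;
         m+n∸m≡n; m≤n+m; m≤m+n; +-monoʳ-≤; +-cancelʳ-≤; <-irrefl; n≤1+n)
open import Data.Nat.Divisibility
  using (_∣_; divides; _∣?_; ∣-refl; ∣⇒≤; ∣m∣n⇒∣m+n; ∣m+n∣m⇒∣n; ∣1⇒≡1; ∣-trans; _∣0; n∣m⇒m%n≡0; m%n≡0⇒n∣m; 0∣⇒≡0)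
open import Data.Nat.GCD using (gcd)
open import Data.Nat.Coprimality using (Coprime; gcd≡1⇒coprime; coprime⇒gcd≡1; prime⇒coprime)
import Data.Nat.Coprimality as Coprimality
open import Data.Nat.Primality
  using (Irreducible; prime⇒irreducible; irreducible⇒prime; prime⇒¬composite; composite[4])
open import Data.Product using (_,_)
open import Data.Sum using (inj₁; inj₂)
open import Data.Bool using (if_then_else_)
open import Relation.Nullary using (yes; no; ¬_; contradiction)
open import Relation.Nullary.Decidable using (does; dec-true; dec-false)
open import Relation.Binary.PropositionalEquality using (refl; sym; trans; cong; cong₂; subst; module ≡-Reasoning)
open import Function.Bundles using (mk⇔; Equivalence)
import Function.Properties.Equivalence as ⇔

open Equivalence using (to; from)

gcdTerm : ℕ → ℕ → ℕ
gcdTerm n x = if does (n % 2 ≟ 0) then gcd n x else gcd (n ∸ 2) x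

increment : ∀ m k → c m (2 + k) ∸ c m (1 + k) ≡ gcdTerm (2 + k) (c m (1 + k))
increment m k = m+n∸m≡n (c m (1 + k)) _

gcdTerm-even : ∀ {n} x → 2 ∣ n → gcdTerm n x ≡ gcd n x
gcdTerm-even {n} x 2∣n =
  cong (if_then gcd n x else gcd (n ∸ 2) x) (dec-true (n % 2 ≟ 0) (n∣m⇒m%n≡0 n 2 2∣n))

gcdTerm-odd : ∀ {n} x → ¬ 2 ∣ n → gcdTerm n x ≡ gcd (n ∸ 2) x
gcdTerm-odd {n} x 2∤n =
  cong (if_then gcd n x else gcd (n ∸ 2) x) (dec-false (n % 2 ≟ 0) (λ n%2≡0 → 2∤n (m%n≡0⇒n∣m n 2 n%2≡0)))

increment-on-line : ∀ m k → c m (1 + k) ≡ m + k → c m (2 + k) ∸ c m (1 + k) ≡ gcdTerm (2 + k) (m + k)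
increment-on-line m k onLine = trans (increment m k) (cong (gcdTerm (2 + k)) onLine)

linear-prefix : ∀ m N →
  (∀ k → 2 + k ≤ N → c m (1 + k) ≡ m + k → c m (2 + k) ∸ c m (1 + k) ≡ 1) →
  ∀ k → 1 + k ≤ N → c m (1 + k) ≡ m + k
linear-prefix m N unit zero    _   = sym (+-identityʳ m)
linear-prefix m N unit (suc k) 2+k≤N = begin
  c m (2 + k)                                   ≡⟨ cong (c m (1 + k) +_) (sym (increment m k)) ⟩
  c m (1 + k) + (c m (2 + k) ∸ c m (1 + k))     ≡⟨ cong₂ _+_ onLine (unit k 2+k≤N onLine) ⟩
  m + k + 1                                     ≡⟨ +-comm (m + k) 1 ⟩
  suc (m + k)                                   ≡⟨ sym (+-suc m k) ⟩
  m + suc k                                     ∎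
  where
  open ≡-Reasoning
  onLine : c m (1 + k) ≡ m + k
  onLine = linear-prefix m N unit k (<⇒≤ 2+k≤N)

-- All increments on [2, N] are 1 iff all gcd terms along the line m + k are 1:
-- under either hypothesis the prefix is linear, and there the two agree.
unitIncrements⇔ : ∀ m N →
  (∀ n → 2 ≤ n → n ≤ N → c m n ∸ c m (n ∸ 1) ≡ 1) ⇔ (∀ k → 2 + k ≤ N → gcdTerm (2 + k) (m + k) ≡ 1)
unitIncrements⇔ m N = mk⇔ toGcds toIncrements
  where
  toGcds : (∀ n → 2 ≤ n → n ≤ N → c m n ∸ c m (n ∸ 1) ≡ 1) → ∀ k → 2 + k ≤ N → gcdTerm (2 + k) (m + k) ≡ 1
  toGcds unit k 2+k≤N = trans (sym (increment-on-line m k (onLine k (<⇒≤ 2+k≤N)))) (unitAt k 2+k≤N)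
    where
    unitAt : ∀ k → 2 + k ≤ N → c m (2 + k) ∸ c m (1 + k) ≡ 1
    unitAt k = unit (2 + k) (s≤s (s≤s z≤n))

    onLine : ∀ k → 1 + k ≤ N → c m (1 + k) ≡ m + k
    onLine = linear-prefix m N (λ k 2+k≤N _ → unitAt k 2+k≤N)

  toIncrements : (∀ k → 2 + k ≤ N → gcdTerm (2 + k) (m + k) ≡ 1) → ∀ n → 2 ≤ n → n ≤ N → c m n ∸ c m (n ∸ 1) ≡ 1
  toIncrements gcds (suc zero)    (s≤s ()) _
  toIncrements gcds (suc (suc k)) _ 2+k≤N = unitOnLine k 2+k≤N (onLine k (<⇒≤ 2+k≤N))
    where
    unitOnLine : ∀ k → 2 + k ≤ N → c m (1 + k) ≡ m + k → c m (2 + k) ∸ c m (1 + k) ≡ 1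
    unitOnLine k 2+k≤N online = trans (increment-on-line m k online) (gcds k 2+k≤N)

    onLine : ∀ k → 1 + k ≤ N → c m (1 + k) ≡ m + k
    onLine = linear-prefix m N unitOnLine

gcd≡1⇔coprime : ∀ {a b} → gcd a b ≡ 1 ⇔ Coprime a b
gcd≡1⇔coprime = mk⇔ gcd≡1⇒coprime coprime⇒gcd≡1

coprime-+ʳ : ∀ {n} y → Coprime n (y + n) ⇔ Coprime n y
coprime-+ʳ {n} y = mk⇔ dropShift addShift
  where
  dropShift : Coprime n (y + n) → Coprime n y
  dropShift cop (d∣n , d∣y) = cop (d∣n , ∣m∣n⇒∣m+n d∣y d∣n)

  addShift : Coprime n y → Coprime n (y + n)
  addShift cop {d} (d∣n , d∣y+n) = cop (d∣n , ∣m+n∣m⇒∣n (subst (d ∣_) (+-comm y n) d∣y+n) d∣n)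

parity-+2 : ∀ {k} → 2 ∣ 2 + k → 2 ∣ k
parity-+2 2∣2+k = ∣m+n∣m⇒∣n 2∣2+k ∣-refl

double-even : ∀ d → 2 ∣ d + d
double-even d = divides d (trans (cong (d +_) (sym (+-identityʳ d))) (*-comm 2 d))

Sieve : ℕ → Set
Sieve p = (∀ k → k ≤ p → 2 ∣ 2 + k → Coprime (2 + k) p)
        × (∀ k → k ≤ p → ¬ 2 ∣ k → Coprime k (2 + p))

line-shift : ∀ p k → 2 + p + k ≡ p + (2 + k)
line-shift p k = trans (cong (_+ k) (+-comm 2 p)) (+-assoc p 2 k)

-- An even step index 2 + k contributes gcd (2 + k) (p + (2 + k)), i.e. coprimality with p.
evenTerm : ∀ p k → 2 ∣ 2 + k → gcdTerm (2 + k) (2 + p + k) ≡ 1 ⇔ Coprime (2 + k) p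
evenTerm p k even =
  subst (λ g → g ≡ 1 ⇔ Coprime (2 + k) p) (sym (gcdTerm-even (2 + p + k) even))
    (subst (λ x → gcd (2 + k) x ≡ 1 ⇔ Coprime (2 + k) p) (sym (line-shift p k))
      (⇔.trans gcd≡1⇔coprime (coprime-+ʳ p)))

-- An odd step index 2 + k contributes gcd k ((2 + p) + k), i.e. coprimality of k with 2 + p.
oddTerm : ∀ p k → ¬ 2 ∣ k → gcdTerm (2 + k) (2 + p + k) ≡ 1 ⇔ Coprime k (2 + p)
oddTerm p k odd =
  subst (λ g → g ≡ 1 ⇔ Coprime k (2 + p)) (sym (gcdTerm-odd (2 + p + k) (λ even → odd (parity-+2 even))))
    (⇔.trans gcd≡1⇔coprime (coprime-+ʳ (2 + p)))

gcdLine⇔sieve : ∀ p → (∀ k → 2 + k ≤ 2 + p → gcdTerm (2 + k) (2 + p + k) ≡ 1) ⇔ Sieve p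
gcdLine⇔sieve p = mk⇔ toSieve fromSieve
  where
  toSieve : (∀ k → 2 + k ≤ 2 + p → gcdTerm (2 + k) (2 + p + k) ≡ 1) → Sieve p
  toSieve gcds = (λ k k≤p even → to (evenTerm p k even) (gcds k (s≤s (s≤s k≤p))))
               , (λ k k≤p odd  → to (oddTerm p k odd) (gcds k (s≤s (s≤s k≤p))))

  fromSieve : Sieve p → ∀ k → 2 + k ≤ 2 + p → gcdTerm (2 + k) (2 + p + k) ≡ 1
  fromSieve (evens , odds) k 2+k≤2+p with 2 ∣? k
  ... | yes 2∣k = from (evenTerm p k even) (evens k k≤p even)
    where
    even : 2 ∣ 2 + k
    even = ∣m∣n⇒∣m+n ∣-refl 2∣k

    k≤p : k ≤ p
    k≤p = s≤s⁻¹ (s≤s⁻¹ 2+k≤2+p)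
  ... | no 2∤k  = from (oddTerm p k 2∤k) (odds k (s≤s⁻¹ (s≤s⁻¹ 2+k≤2+p)) 2∤k)

proper-divisor-half : ∀ {d n} → d ∣ n → 0 < n → d < n → d + d ≤ n
proper-divisor-half (divides zero refl) () _
proper-divisor-half {d} (divides (suc zero) refl) _ d<d+0 = contradiction d<d+0 (<-irrefl (sym (+-identityʳ d)))
proper-divisor-half {d} (divides (suc (suc q)) refl) _ _ = +-monoʳ-≤ d (m≤m+n d (q * d))

odd-divisor-half : ∀ {d n} → ¬ 2 ∣ d → d ∣ n → 2 ∣ n → 0 < n → d + d ≤ n
odd-divisor-half {d} {suc n} odd d∣n even 0<n with m≤n⇒m<n∨m≡n (∣⇒≤ d∣n)
... | inj₁ d<n  = proper-divisor-half d∣n 0<n d<n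
... | inj₂ refl = contradiction even odd

irreducible-without-middle-divisors : ∀ {n} → 0 < n → (∀ {d} → d ∣ n → 1 < d → d < n → d ≡ 1) → Irreducible n
irreducible-without-middle-divisors {suc n} _ _ {zero} 0∣n with 0∣⇒≡0 0∣n
... | ()
irreducible-without-middle-divisors _ _ {suc zero} _ = inj₁ refl
irreducible-without-middle-divisors {suc n} _ middle {suc (suc e)} d∣n with m≤n⇒m<n∨m≡n (∣⇒≤ d∣n)
... | inj₁ d<n = inj₁ (middle d∣n (s≤s (s≤s z≤n)) d<n)
... | inj₂ d≡n = inj₂ d≡n

-- The smaller of twin primes is odd: otherwise p = 2 and 2 + p = 4 would be prime.
twin-odd : ∀ {p} → Prime p → Prime (2 + p) → ¬ 2 ∣ p
twin-odd pp p2 2∣p with prime⇒irreducible pp 2∣p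
... | inj₁ ()
... | inj₂ refl = prime⇒¬composite p2 composite[4]

-- Twin primes satisfy the sieve: an odd prime p divides no even n ≤ 2 + p,
-- and every positive d ≤ p lies below the prime 2 + p.
twin⇒sieve : ∀ {p} → 2 ≤ p → Prime p → Prime (2 + p) → Sieve p
twin⇒sieve {p} 2≤p pp p2 = evens , odds
  where
  p-odd : ¬ 2 ∣ p
  p-odd = twin-odd pp p2

  evens : ∀ k → k ≤ p → 2 ∣ 2 + k → Coprime (2 + k) p
  evens k k≤p even (d∣2+k , d∣p) with prime⇒irreducible pp d∣p
  ... | inj₁ d≡1 = d≡1
  ... | inj₂ refl = contradiction (subst (2 ∣_) (≤-antisym 2≤p p≤2) ∣-refl) p-odd
    where
    p≤2 : p ≤ 2
    p≤2 = +-cancelʳ-≤ p p 2 (≤-trans (odd-divisor-half p-odd d∣2+k even (s≤s z≤n)) (s≤s (s≤s k≤p)))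

  odds : ∀ k → k ≤ p → ¬ 2 ∣ k → Coprime k (2 + p)
  odds zero    _   odd = contradiction (2 ∣0) odd
  odds (suc k) k<p _   = Coprimality.sym (prime⇒coprime p2 (s≤s (≤-trans k<p (n≤1+n p))))

-- Coprimality of 2 with p makes p and 2 + p odd.
-- A divisor 1 < d < p gives the even number d + d ≤ p sharing d with p; a
-- divisor 1 < d < 2 + p is odd, is not 1 + p, and so is an odd d ≤ p.
sieve⇒twin : ∀ {p} → 2 ≤ p → Sieve p → Prime p × Prime (2 + p)
sieve⇒twin {p} 2≤p (evens , odds) =
    irreducible⇒prime {{n>1⇒nonTrivial 2≤p}} (irreducible-without-middle-divisors 0<p middleOfP)
  , irreducible⇒prime (irreducible-without-middle-divisors (s≤s z≤n) middleOf2+p)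
  where
  0<p : 0 < p
  0<p = ≤-trans (s≤s z≤n) 2≤p

  p-odd : ¬ 2 ∣ p
  p-odd 2∣p with evens 0 z≤n ∣-refl (∣-refl , 2∣p)
  ... | ()

  middleOfP : ∀ {d} → d ∣ p → 1 < d → d < p → d ≡ 1
  middleOfP {suc zero} _ (s≤s ()) _
  -- For d = 2 + e the even number d + d is 2 + k with k = e + (2 + e).
  middleOfP {suc (suc e)} d∣p _ d<p =
    evens (e + suc (suc e)) (≤-trans (m≤n+m _ 2) (proper-divisor-half d∣p 0<p d<p)) (double-even (suc (suc e)))
          (∣m∣n⇒∣m+n ∣-refl ∣-refl , d∣p)

  middleOf2+p : ∀ {d} → d ∣ 2 + p → 1 < d → d < 2 + p → d ≡ 1
  middleOf2+p {d} d∣2+p _ d<2+p with m≤n⇒m<n∨m≡n (s≤s⁻¹ d<2+p) | 2 ∣? d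
  ... | inj₂ refl | _       = ∣1⇒≡1 (∣m+n∣m⇒∣n (subst (d ∣_) (+-comm 1 d) d∣2+p) ∣-refl)
  ... | inj₁ d<1+p | yes 2∣d = contradiction (parity-+2 (∣-trans 2∣d d∣2+p)) p-odd
  ... | inj₁ d<1+p | no 2∤d  = odds d (s≤s⁻¹ d<1+p) 2∤d (∣-refl , d∣2+p)

mainTheorem9 : (m : ℕ) → 3 < m →
    (Prime (m ∸ 2) × Prime m) ⇔ (∀ n → 2 ≤ n → n ≤ m → c m n ∸ c m (n ∸ 1) ≡ 1)
mainTheorem9 (suc zero) (s≤s ())
mainTheorem9 (suc (suc p)) 3<m =
  ⇔.trans (mk⇔ (λ (pp , p2) → twin⇒sieve 2≤p pp p2) (sieve⇒twin 2≤p))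
          (⇔.sym (⇔.trans (unitIncrements⇔ (2 + p) (2 + p)) (gcdLine⇔sieve p)))
  where
  2≤p : 2 ≤ p
  2≤p = s≤s⁻¹ (s≤s⁻¹ 3<m)
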